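{- Let $a$ and $b$ be disjoint subsets of $\dot V$. Then (i) $\partial([a,b])=2\sum_{a^*}[a^*,b]$, where the sum runs over all $a^*\subset a$ with $|a^*|=|a|-1$; and (ii) $\epsilon([a,b])=\sum_{\gamma\in\dot V\setminus a}[a\cup\{\gamma\},b]$ (with the convention $[a',b]=0$ whenever $a'\cap b\ne\emptyset$).
   Context: Let $\mathbb F$ be a field. Let $V=\{\alpha_1,\bar\alpha_1,\dots,\alpha_n,\bar\alpha_n\}$ be a set of $2n$ distinct elements, with $\bar{\bar\alpha}_i=\alpha_i$. For $0\le k\le n$, $L^n_k$ is the set of $k$-element subsets $x\subseteq V$ with $|x\cap\{\alpha_i,\bar\alpha_i\}|\le1$ for all $i$; $M^n_k$ is the $\mathbb F$-vector space with basis $L^n_k$ and $M^n=\bigoplus_k M^n_k$. Elements are written as polynomials in the vertices: a product of distinct vertices forming such a set denotes that set, extended bilinearly. The linear maps $\epsilon,\partial:M^n\to M^n$ are given on $x\in L^n_k$ by $\epsilon(x)=\sum_{y\in L^n_{k+1},\,y\supset x}y$ and $\partial(x)=\sum_{z\in L^n_{k-1},\,z\subset x}z$. Let $\dot V=\{\alpha_1,\dots,\alpha_n\}$; for disjoint $a,b\subseteq\dot V$, $[a,b]=\prod_{\alpha\in a}(\alpha+\bar\alpha)\prod_{\beta\in b}(\beta-\bar\beta)$, with $[\emptyset,\emptyset]=\emptyset$, and $[a,b]=0$ if $a\cap b\neq\emptyset$. -}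

module Defs where

open import Level using (Level; _⊔_) renaming (suc to lsuc)
open import Algebra.Bundles using (CommutativeRing)
open import Data.Nat using (ℕ; zero; suc)
open import Data.Fin using (Fin)
open import Data.Bool using (Bool; true; false; if_then_else_)
open import Data.Maybe using (Maybe; just; nothing)
open import Data.List using (List; []; _∷_; map; _++_; foldr)
open import Data.Vec using (Vec; []; _∷_; lookup)
import Data.Vec.Properties as VecP
import Data.Maybe.Properties as MaybeP
import Data.Bool.Properties as BoolP
open import Data.Product using (Σ)
open import Data.Fin.Subset using (Subset)
open import Data.Fin using (Fin)
open import Data.List using () renaming (allFin to allFinL)
open import Relation.Nullary using (¬_; Dec; yes; no)
open import Relation.Binary.PropositionalEquality using (_≡_)

record Field (c ℓ : Level) : Set (lsuc (c ⊔ ℓ)) where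
  field
    commutativeRing : CommutativeRing c ℓ
  open CommutativeRing commutativeRing public
  field
    0≉1     : ¬ (0# ≈ 1#)
    inverse : ∀ x → ¬ (x ≈ 0#) → Σ Carrier (λ y → (x * y) ≈ 1#)

-- Basis elements of M^n: a set x ⊆ V with |x ∩ {α_i, ᾱ_i}| ≤ 1 is encoded by
-- its i-th coordinate: nothing (neither), just false (α_i), just true (ᾱ_i).
-- The grade k is the number of non-nothing coordinates; M^n = ⊕_k M^n_k.
Basis : ℕ → Set
Basis n = Vec (Maybe Bool) n

_≟B_ : ∀ {n} (x y : Basis n) → Dec (x ≡ y)
_≟B_ = VecP.≡-dec (MaybeP.≡-dec BoolP._≟_)

allBasis : ∀ n → List (Basis n)
allBasis zero    = [] ∷ []
allBasis (suc n) = map (nothing ∷_) (allBasis n)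
                ++ map (just false ∷_) (allBasis n)
                ++ map (just true ∷_) (allBasis n)

ups : ∀ {n} → Basis n → List (Basis n)
ups []             = []
ups (nothing ∷ x)  = (just false ∷ x) ∷ (just true ∷ x) ∷ map (nothing ∷_) (ups x)
ups (just s ∷ x)   = map (just s ∷_) (ups x)

downs : ∀ {n} → Basis n → List (Basis n)
downs []            = []
downs (nothing ∷ x) = map (nothing ∷_) (downs x)
downs (just s ∷ x)  = (nothing ∷ x) ∷ map (just s ∷_) (downs x)

module Over {c ℓ : Level} (F : Field c ℓ) where
  open Field F

  M : ℕ → Set c
  M n = Basis n → Carrier

  _≋_ : ∀ {n} → M n → M n → Set ℓ
  f ≋ g = ∀ y → f y ≈ g y

  0M : ∀ {n} → M n
  0M _ = 0#

  _⊕_ : ∀ {n} → M n → M n → M n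
  (f ⊕ g) y = f y + g y

  _·_ : ∀ {n} → Carrier → M n → M n
  (r · f) y = r * f y

  ΣM : ∀ {n} {A : Set} → List A → (A → M n) → M n
  ΣM xs h = foldr (λ x acc → h x ⊕ acc) 0M xs

  δ : ∀ {n} → Basis n → M n
  δ x y with x ≟B y
  ... | yes _ = 1#
  ... | no  _ = 0#

  linExt : ∀ {n} → (Basis n → M n) → M n → M n
  linExt {n} T f = ΣM (allBasis n) (λ x → f x · T x)

  ε : ∀ {n} → M n → M n
  ε = linExt (λ x → ΣM (ups x) δ)

  ∂ : ∀ {n} → M n → M n
  ∂ = linExt (λ x → ΣM (downs x) δ)

  -- one coordinate factor of [a,b]:
  --   i ∉ a ∪ b : the empty set (unit)     i ∈ a only : α_i + ᾱ_i
  --   i ∈ b only : α_i - ᾱ_i               i ∈ a ∩ b  : 0  (convention [a,b] = 0)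
  factor : Bool → Bool → Maybe Bool → Carrier
  factor false false nothing       = 1#
  factor false false (just _)      = 0#
  factor true  false nothing       = 0#
  factor true  false (just _)      = 1#
  factor false true  nothing       = 0#
  factor false true  (just false)  = 1#
  factor false true  (just true)   = - 1#
  factor true  true  _             = 0#

  -- [a,b] = ∏_{α∈a}(α+ᾱ) ∏_{β∈b}(β-β̄), expanded coefficientwise
  -- (coefficient of y is the product of the coordinate factors)
  [_,_] : ∀ {n} → Subset n → Subset n → M n
  [ []    , []    ] []      = 1#
  [ p ∷ a , q ∷ b ] (z ∷ y) = factor p q z * [ a , b ] y

  Σ∈ : ∀ {n} → Subset n → (Fin n → M n) → M n
  Σ∈ {n} s h = ΣM (allFinL n) (λ i → if lookup s i then h i else 0M)

  Σ∉ : ∀ {n} → Subset n → (Fin n → M n) → M n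
  Σ∉ {n} s h = ΣM (allFinL n) (λ i → if lookup s i then 0M else h i)

  2# : Carrier
  2# = 1# + 1#

-- Coefficientwise, ∂ and ε are transposes of each other with respect to the
-- basis L^n: the coefficient of y in ∂ f is the sum of f over the covers
-- y ∪ {v} of y, and in ε f the sum of f over the sets y - {v}.  For a product
-- [a,b] = ⊗ᵢ vᵢ of one-coordinate factors these sums obey a Leibniz rule, so
-- the theorem reduces, by induction on n, to the one-coordinate computations
-- ∂(α+ᾱ) = 2∅, ∂(α-ᾱ) = ∂∅ = 0 and ε∅ = α+ᾱ, ε(α±ᾱ) = 0.
module Submission where

open import Defs
open import Data.Nat using (ℕ; zero; suc)
open import Data.Product using (_×_; _,_)
open import Data.Bool using (Bool; true; false; if_then_else_; not; _∧_)
open import Data.Bool.Properties using (∨-identityʳ)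
import Data.Bool as Bool
open import Data.Maybe.Properties using (just-injective)
open import Data.Maybe using (Maybe; just; nothing)
open import Data.Fin using (Fin; zero; suc)
open import Data.Fin.Subset using (Subset; _∩_; _∪_; _-_; ⁅_⁆; ∁; Empty)
open import Data.Fin.Subset.Properties using (drop-∷-Empty; Empty-unique; ∪-identityʳ; p─⊥≡p)
open import Data.List using (List; []; _∷_; map; _++_; allFin)
open import Data.List.Properties using (map-tabulate)
open import Data.Vec using ([]; _∷_; lookup)
open import Data.Vec.Properties using (∷-injectiveˡ; ∷-injectiveʳ; lookup-map)
open import Data.Empty using (⊥-elim)
open import Function using (id)
open import Relation.Nullary using (¬_; Dec; yes; no)
import Relation.Binary.PropositionalEquality as ≡
open ≡ using (_≡_)
import Algebra.Properties.CommutativeSemigroup as CommSemigroupProperties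

module Coefficients {c ℓ} (F : Field c ℓ) where
  open Field F hiding (zero; _-_)
  open Over F
  open import Relation.Binary.Reasoning.Setoid setoid
  open CommSemigroupProperties *-commutativeSemigroup using (x∙yz≈y∙xz)
  open CommSemigroupProperties +-commutativeSemigroup using () renaming (interchange to +-interchange)

  ∑ : ∀ {A : Set} → List A → (A → Carrier) → Carrier
  ∑ []       g = 0#
  ∑ (x ∷ xs) g = g x + ∑ xs g

  ΣM-apply : ∀ {n} {A : Set} (xs : List A) (h : A → M n) y → ΣM xs h y ≡ ∑ xs (λ x → h x y)
  ΣM-apply []       h y = ≡.refl
  ΣM-apply (x ∷ xs) h y = ≡.cong (h x y +_) (ΣM-apply xs h y)

  ∑-cong : ∀ {A : Set} (xs : List A) {g h : A → Carrier} → (∀ x → g x ≈ h x) → ∑ xs g ≈ ∑ xs h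
  ∑-cong []       g≈h = refl
  ∑-cong (x ∷ xs) g≈h = +-cong (g≈h x) (∑-cong xs g≈h)

  ∑-zero : ∀ {A : Set} (xs : List A) → ∑ xs (λ _ → 0#) ≈ 0#
  ∑-zero []       = refl
  ∑-zero (x ∷ xs) = trans (+-identityˡ _) (∑-zero xs)

  ∑-map : ∀ {A B : Set} (f : A → B) (xs : List A) g → ∑ (map f xs) g ≡ ∑ xs (λ x → g (f x))
  ∑-map f []       g = ≡.refl
  ∑-map f (x ∷ xs) g = ≡.cong (g (f x) +_) (∑-map f xs g)

  ∑-++ : ∀ {A : Set} (xs ys : List A) g → ∑ (xs ++ ys) g ≈ ∑ xs g + ∑ ys g
  ∑-++ []       ys g = sym (+-identityˡ _)
  ∑-++ (x ∷ xs) ys g = trans (+-congˡ (∑-++ xs ys g)) (sym (+-assoc _ _ _))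

  ∑-distribˡ : ∀ {A : Set} r (xs : List A) g → r * ∑ xs g ≈ ∑ xs (λ x → r * g x)
  ∑-distribˡ r []       g = zeroʳ r
  ∑-distribˡ r (x ∷ xs) g = trans (distribˡ r _ _) (+-congˡ (∑-distribˡ r xs g))

  ∑-+ : ∀ {A : Set} (xs : List A) g h → ∑ xs (λ x → g x + h x) ≈ ∑ xs g + ∑ xs h
  ∑-+ []       g h = sym (+-identityˡ 0#)
  ∑-+ (x ∷ xs) g h = trans (+-congˡ (∑-+ xs g h)) (+-interchange _ _ _ _)

  ∑-swap : ∀ {A B : Set} (xs : List A) (ys : List B) (g : A → B → Carrier) →
           ∑ xs (λ x → ∑ ys (g x)) ≈ ∑ ys (λ y → ∑ xs (λ x → g x y))
  ∑-swap []       ys g = sym (∑-zero ys)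
  ∑-swap (x ∷ xs) ys g =
    trans (+-congˡ (∑-swap xs ys g)) (sym (∑-+ ys (g x) (λ y → ∑ xs (λ x′ → g x′ y))))

  δ-≢ : ∀ {n} (x y : Basis n) → ¬ x ≡ y → δ x y ≡ 0#
  δ-≢ x y x≢y with x ≟B y
  ... | yes x≡y = ⊥-elim (x≢y x≡y)
  ... | no  _   = ≡.refl

  δ-refl : ∀ {n} (x : Basis n) → δ x x ≡ 1#
  δ-refl x with x ≟B x
  ... | yes _   = ≡.refl
  ... | no  x≢x = ⊥-elim (x≢x ≡.refl)

  δ-sym : ∀ {n} (x y : Basis n) → δ x y ≡ δ y x
  δ-sym x y = by-cases (x ≟B y)
    where
    by-cases : Dec (x ≡ y) → δ x y ≡ δ y x
    by-cases (yes ≡.refl) = ≡.refl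
    by-cases (no  x≢y)    = ≡.trans (δ-≢ x y x≢y) (≡.sym (δ-≢ y x (λ y≡x → x≢y (≡.sym y≡x))))

  δ-∷ : ∀ {n} u (x y : Basis n) → δ (u ∷ x) (u ∷ y) ≡ δ x y
  δ-∷ u x y = by-cases (x ≟B y)
    where
    by-cases : Dec (x ≡ y) → δ (u ∷ x) (u ∷ y) ≡ δ x y
    by-cases (yes ≡.refl) = ≡.trans (δ-refl (u ∷ x)) (≡.sym (δ-refl x))
    by-cases (no  x≢y)    = ≡.trans (δ-≢ (u ∷ x) (u ∷ y) (λ e → x≢y (∷-injectiveʳ e))) (≡.sym (δ-≢ x y x≢y))

  δ-sift : ∀ {n} (f : M n) x w → f x * δ w x ≈ f w * δ x w
  δ-sift f x w = by-cases (w ≟B x)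
    where
    by-cases : Dec (w ≡ x) → f x * δ w x ≈ f w * δ x w
    by-cases (yes ≡.refl) = refl
    by-cases (no  w≢x)    = begin
      f x * δ w x ≈⟨ *-congˡ (reflexive (δ-≢ w x w≢x)) ⟩
      f x * 0#    ≈⟨ zeroʳ _ ⟩
      0#          ≈⟨ zeroʳ _ ⟨
      f w * 0#    ≈⟨ *-congˡ (reflexive (δ-≢ x w (λ x≡w → w≢x (≡.sym x≡w)))) ⟨
      f w * δ x w ∎

  count : ∀ {n} → List (Basis n) → Basis n → Carrier
  count zs y = ∑ zs (λ z → δ z y)

  count-map-∷ : ∀ {n} u (zs : List (Basis n)) y → count (map (u ∷_) zs) (u ∷ y) ≈ count zs y
  count-map-∷ u zs y = trans (reflexive (∑-map (u ∷_) zs _)) (∑-cong zs (λ z → reflexive (δ-∷ u z y)))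

  count-map-∷-≢ : ∀ {n} {u v} (zs : List (Basis n)) y → ¬ u ≡ v → count (map (u ∷_) zs) (v ∷ y) ≈ 0#
  count-map-∷-≢ {u = u} {v} zs y u≢v = begin
    count (map (u ∷_) zs) (v ∷ y) ≡⟨ ∑-map (u ∷_) zs _ ⟩
    ∑ zs (λ z → δ (u ∷ z) (v ∷ y)) ≈⟨ ∑-cong zs (λ z → reflexive (δ-≢ (u ∷ z) (v ∷ y) (λ e → u≢v (∷-injectiveˡ e)))) ⟩
    ∑ zs (λ _ → 0#)                ≈⟨ ∑-zero zs ⟩
    0#                             ∎

  count-allBasis-∷ : ∀ {n} (u : Maybe Bool) (y : Basis n) →
    count (allBasis (suc n)) (u ∷ y) ≈
      count (map (nothing ∷_) (allBasis n)) (u ∷ y)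
      + (count (map (just false ∷_) (allBasis n)) (u ∷ y) + count (map (just true ∷_) (allBasis n)) (u ∷ y))
  count-allBasis-∷ {n} u y =
    trans (∑-++ (map (nothing ∷_) A) _ _) (+-congˡ (∑-++ (map (just false ∷_) A) _ _))
    where A = allBasis n

  count-allBasis : ∀ n (y : Basis n) → count (allBasis n) y ≈ 1#
  count-allBasis zero    [] = trans (+-identityʳ _) (reflexive (δ-refl []))
  count-allBasis (suc n) (nothing ∷ y) = begin
    count (allBasis (suc n)) (nothing ∷ y) ≈⟨ count-allBasis-∷ nothing y ⟩
      _ ≈⟨ +-cong (count-map-∷ nothing A y)
                  (+-cong (count-map-∷-≢ A y (λ ())) (count-map-∷-≢ A y (λ ()))) ⟩
    count A y + (0# + 0#)                  ≈⟨ +-cong (count-allBasis n y) (+-identityʳ 0#) ⟩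
    1# + 0#                                ≈⟨ +-identityʳ 1# ⟩
    1#                                     ∎
    where A = allBasis n
  count-allBasis (suc n) (just false ∷ y) = begin
    count (allBasis (suc n)) (just false ∷ y) ≈⟨ count-allBasis-∷ (just false) y ⟩
      _ ≈⟨ +-cong (count-map-∷-≢ A y (λ ()))
                  (+-cong (count-map-∷ (just false) A y) (count-map-∷-≢ A y (λ ()))) ⟩
    0# + (count A y + 0#)                     ≈⟨ trans (+-identityˡ _) (+-identityʳ _) ⟩
    count A y                                 ≈⟨ count-allBasis n y ⟩
    1#                                        ∎
    where A = allBasis n
  count-allBasis (suc n) (just true ∷ y) = begin
    count (allBasis (suc n)) (just true ∷ y) ≈⟨ count-allBasis-∷ (just true) y ⟩
      _ ≈⟨ +-cong (count-map-∷-≢ A y (λ ()))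
                  (+-cong (count-map-∷-≢ A y (λ ())) (count-map-∷ (just true) A y)) ⟩
    0# + (0# + count A y)                    ≈⟨ trans (+-identityˡ _) (+-identityˡ _) ⟩
    count A y                                ≈⟨ count-allBasis n y ⟩
    1#                                       ∎
    where A = allBasis n

  ∑-allBasis-δ : ∀ {n} (f : M n) w → ∑ (allBasis n) (λ x → f x * δ w x) ≈ f w
  ∑-allBasis-δ {n} f w = begin
    ∑ (allBasis n) (λ x → f x * δ w x) ≈⟨ ∑-cong (allBasis n) (λ x → δ-sift f x w) ⟩
    ∑ (allBasis n) (λ x → f w * δ x w) ≈⟨ ∑-distribˡ (f w) (allBasis n) _ ⟨
    f w * count (allBasis n) w         ≈⟨ *-congˡ (count-allBasis n w) ⟩
    f w * 1#                           ≈⟨ *-identityʳ (f w) ⟩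
    f w                                ∎

  -- δ of two vectors with distinct constructor heads computes to 0#; the bare
  -- +-identity steps below discard such terms.
  count-downs-ups : ∀ {n} (x y : Basis n) → count (downs x) y ≈ count (ups y) x
  count-downs-ups [] [] = refl
  count-downs-ups (nothing ∷ x) (nothing ∷ y) = begin
    count (map (nothing ∷_) (downs x)) (nothing ∷ y) ≈⟨ count-map-∷ nothing (downs x) y ⟩
    count (downs x) y                                ≈⟨ count-downs-ups x y ⟩
    count (ups y) x                                  ≈⟨ count-map-∷ nothing (ups y) x ⟨
    count (map (nothing ∷_) (ups y)) (nothing ∷ x)   ≈⟨ trans (+-identityˡ _) (+-identityˡ _) ⟨
    count (ups (nothing ∷ y)) (nothing ∷ x)          ∎
  count-downs-ups (nothing ∷ x) (just t ∷ y) =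
    trans (count-map-∷-≢ (downs x) y (λ ())) (sym (count-map-∷-≢ (ups y) x (λ ())))
  count-downs-ups (just s ∷ x) (nothing ∷ y) = begin
    δ (nothing ∷ x) (nothing ∷ y) + count (map (just s ∷_) (downs x)) (nothing ∷ y)
      ≈⟨ +-cong (reflexive (δ-∷ nothing x y)) (count-map-∷-≢ (downs x) y (λ ())) ⟩
    δ x y + 0#                                   ≈⟨ +-identityʳ _ ⟩
    δ x y                                        ≈⟨ reflexive (δ-sym x y) ⟩
    δ y x                                        ≈⟨ cover s ⟨
    count (ups (nothing ∷ y)) (just s ∷ x)       ∎
    where
    cover : ∀ s → count (ups (nothing ∷ y)) (just s ∷ x) ≈ δ y x
    cover false = trans (+-cong (reflexive (δ-∷ (just false) y x))
                                (trans (+-identityˡ _) (count-map-∷-≢ (ups y) x (λ ()))))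
                        (+-identityʳ _)
    cover true  = trans (+-identityˡ _)
                        (trans (+-cong (reflexive (δ-∷ (just true) y x)) (count-map-∷-≢ (ups y) x (λ ())))
                               (+-identityʳ _))
  count-downs-ups (just s ∷ x) (just t ∷ y) with s Bool.≟ t
  ... | yes ≡.refl = begin
    0# + count (map (just s ∷_) (downs x)) (just s ∷ y) ≈⟨ +-identityˡ _ ⟩
    count (map (just s ∷_) (downs x)) (just s ∷ y)      ≈⟨ count-map-∷ (just s) (downs x) y ⟩
    count (downs x) y                                   ≈⟨ count-downs-ups x y ⟩
    count (ups y) x                                     ≈⟨ count-map-∷ (just s) (ups y) x ⟨
    count (map (just s ∷_) (ups y)) (just s ∷ x)        ∎
  ... | no s≢t = trans (+-identityˡ _)
    (trans (count-map-∷-≢ (downs x) y (λ e → s≢t (just-injective e)))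
           (sym (count-map-∷-≢ (ups y) x (λ e → s≢t (≡.sym (just-injective e))))))

  linExt-coeff : ∀ {n} (T T′ : Basis n → List (Basis n)) →
    (∀ x y → count (T x) y ≈ count (T′ y) x) →
    ∀ (f : M n) y → linExt (λ x → ΣM (T x) δ) f y ≈ ∑ (T′ y) f
  linExt-coeff {n} T T′ transpose f y = begin
    linExt (λ x → ΣM (T x) δ) f y             ≡⟨ ΣM-apply B _ y ⟩
    ∑ B (λ x → f x * ΣM (T x) δ y)            ≈⟨ ∑-cong B (λ x → *-congˡ (reflexive (ΣM-apply (T x) δ y))) ⟩
    ∑ B (λ x → f x * count (T x) y)           ≈⟨ ∑-cong B (λ x → *-congˡ (transpose x y)) ⟩
    ∑ B (λ x → f x * count (T′ y) x)          ≈⟨ ∑-cong B (λ x → ∑-distribˡ (f x) (T′ y) _) ⟩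
    ∑ B (λ x → ∑ (T′ y) (λ w → f x * δ w x))  ≈⟨ ∑-swap B (T′ y) _ ⟩
    ∑ (T′ y) (λ w → ∑ B (λ x → f x * δ w x))  ≈⟨ ∑-cong (T′ y) (∑-allBasis-δ f) ⟩
    ∑ (T′ y) f                                ∎
    where B = allBasis n

  ∂-coeff : ∀ {n} (f : M n) y → ∂ f y ≈ ∑ (ups y) f
  ∂-coeff = linExt-coeff downs ups count-downs-ups

  ε-coeff : ∀ {n} (f : M n) y → ε f y ≈ ∑ (downs y) f
  ε-coeff = linExt-coeff ups downs (λ x y → sym (count-downs-ups y x))

  _⊗_ : ∀ {n} → (Maybe Bool → Carrier) → M n → M (suc n)
  (v ⊗ f) (u ∷ y) = v u * f y

  ∂₁ ε₁ : (Maybe Bool → Carrier) → Maybe Bool → Carrier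
  ∂₁ v nothing  = v (just false) + v (just true)
  ∂₁ v (just _) = 0#
  ε₁ v nothing  = 0#
  ε₁ v (just _) = v nothing

  ∑-map-∷-⊗ : ∀ {n} u (zs : List (Basis n)) v f → ∑ (map (u ∷_) zs) (v ⊗ f) ≈ v u * ∑ zs f
  ∑-map-∷-⊗ u zs v f = trans (reflexive (∑-map (u ∷_) zs (v ⊗ f))) (sym (∑-distribˡ (v u) zs f))

  ∑-ups-⊗ : ∀ {n} v (f : M n) u y → ∑ (ups (u ∷ y)) (v ⊗ f) ≈ ∂₁ v u * f y + v u * ∑ (ups y) f
  ∑-ups-⊗ v f nothing y = begin
    v (just false) * f y + (v (just true) * f y + ∑ (map (nothing ∷_) (ups y)) (v ⊗ f))
      ≈⟨ +-congˡ (+-congˡ (∑-map-∷-⊗ nothing (ups y) v f)) ⟩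
    v (just false) * f y + (v (just true) * f y + v nothing * ∑ (ups y) f)
      ≈⟨ +-assoc _ _ _ ⟨
    (v (just false) * f y + v (just true) * f y) + v nothing * ∑ (ups y) f
      ≈⟨ +-congʳ (distribʳ (f y) _ _) ⟨
    (v (just false) + v (just true)) * f y + v nothing * ∑ (ups y) f
      ∎
  ∑-ups-⊗ v f (just t) y = begin
    ∑ (map (just t ∷_) (ups y)) (v ⊗ f) ≈⟨ ∑-map-∷-⊗ (just t) (ups y) v f ⟩
    v (just t) * ∑ (ups y) f            ≈⟨ +-identityˡ _ ⟨
    0# + v (just t) * ∑ (ups y) f       ≈⟨ +-congʳ (zeroˡ (f y)) ⟨
    0# * f y + v (just t) * ∑ (ups y) f ∎

  ∑-downs-⊗ : ∀ {n} v (f : M n) u y → ∑ (downs (u ∷ y)) (v ⊗ f) ≈ ε₁ v u * f y + v u * ∑ (downs y) f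
  ∑-downs-⊗ v f nothing y = begin
    ∑ (map (nothing ∷_) (downs y)) (v ⊗ f) ≈⟨ ∑-map-∷-⊗ nothing (downs y) v f ⟩
    v nothing * ∑ (downs y) f              ≈⟨ +-identityˡ _ ⟨
    0# + v nothing * ∑ (downs y) f         ≈⟨ +-congʳ (zeroˡ (f y)) ⟨
    0# * f y + v nothing * ∑ (downs y) f   ∎
  ∑-downs-⊗ v f (just s) y = +-congˡ (∑-map-∷-⊗ (just s) (downs y) v f)

  ∑∈ : ∀ {n} → Subset n → (Fin n → Carrier) → Carrier
  ∑∈ {n} s g = ∑ (allFin n) (λ i → if lookup s i then g i else 0#)

  ∑-allFin-suc : ∀ n (g : Fin (suc n) → Carrier) →
                 ∑ (allFin (suc n)) g ≡ g zero + ∑ (allFin n) (λ i → g (suc i))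
  ∑-allFin-suc n g = ≡.cong (g zero +_)
    (≡.trans (≡.cong (λ is → ∑ is g) (≡.sym (map-tabulate id suc))) (∑-map suc (allFin n) g))

  ∑∈-∷ : ∀ {n} p (s : Subset n) g → ∑∈ (p ∷ s) g ≡ (if p then g zero else 0#) + ∑∈ s (λ i → g (suc i))
  ∑∈-∷ {n} p s g = ∑-allFin-suc n _

  if-distribˡ : ∀ b r x → r * (if b then x else 0#) ≈ (if b then r * x else 0#)
  if-distribˡ true  r x = refl
  if-distribˡ false r x = zeroʳ r

  ∑∈-distribˡ : ∀ {n} r (s : Subset n) g → r * ∑∈ s g ≈ ∑∈ s (λ i → r * g i)
  ∑∈-distribˡ {n} r s g = trans (∑-distribˡ r (allFin n) _)
                                (∑-cong (allFin n) (λ i → if-distribˡ (lookup s i) r (g i)))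

  apply-if : ∀ {n} b (g : M n) y → (if b then g else 0M) y ≡ (if b then g y else 0#)
  apply-if true  g y = ≡.refl
  apply-if false g y = ≡.refl

  Σ∈-apply : ∀ {n} (s : Subset n) h y → Σ∈ s h y ≈ ∑∈ s (λ i → h i y)
  Σ∈-apply {n} s h y = trans (reflexive (ΣM-apply (allFin n) _ y))
                             (∑-cong (allFin n) (λ i → reflexive (apply-if (lookup s i) (h i) y)))

  Σ∉-apply : ∀ {n} (s : Subset n) h y → Σ∉ s h y ≈ ∑∈ (∁ s) (λ i → h i y)
  Σ∉-apply {n} s h y = trans (reflexive (ΣM-apply (allFin n) _ y))
                             (∑-cong (allFin n) (λ i → reflexive (apply-if-not i)))
    where
    apply-if-not : ∀ i → (if lookup s i then 0M else h i) y ≡ (if lookup (∁ s) i then h i y else 0#)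
    apply-if-not i rewrite lookup-map i not s with lookup s i
    ... | true  = ≡.refl
    ... | false = ≡.refl

  ∂₁-factor : ∀ p q → p ∧ q ≡ false → ∀ u → ∂₁ (factor p q) u ≈ 2# * (if p then factor false q u else 0#)
  ∂₁-factor false false _ nothing  = trans (+-identityʳ 0#) (sym (zeroʳ 2#))
  ∂₁-factor true  false _ nothing  = sym (*-identityʳ 2#)
  ∂₁-factor false true  _ nothing  = trans (-‿inverseʳ 1#) (sym (zeroʳ 2#))
  ∂₁-factor false q     _ (just _) = sym (zeroʳ 2#)
  ∂₁-factor true  false _ (just _) = sym (zeroʳ 2#)
  ∂₁-factor true  true  ()

  ε₁-factor : ∀ p q → p ∧ q ≡ false → ∀ u → ε₁ (factor p q) u ≈ (if not p then factor true q u else 0#)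
  ε₁-factor false false _ nothing  = refl
  ε₁-factor false true  _ nothing  = refl
  ε₁-factor true  false _ nothing  = refl
  ε₁-factor false false _ (just _) = refl
  ε₁-factor false true  _ (just _) = refl
  ε₁-factor true  false _ (just _) = refl
  ε₁-factor true  true  ()

  bracket-∷ : ∀ {n} p q (a b : Subset n) w → [ p ∷ a , q ∷ b ] w ≈ (factor p q ⊗ [ a , b ]) w
  bracket-∷ p q a b (u ∷ y) = refl

  head-disjoint : ∀ {n} p q {a b : Subset n} → Empty ((p ∷ a) ∩ (q ∷ b)) → p ∧ q ≡ false
  head-disjoint p q disj = ∷-injectiveˡ (Empty-unique disj)

  pull-scalar : ∀ k h x v s → (k * h) * x + v * (k * s) ≈ k * (h * x + v * s)
  pull-scalar k h x v s = begin
    (k * h) * x + v * (k * s) ≈⟨ +-cong (*-assoc k h x) (x∙yz≈y∙xz v k s) ⟩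
    k * (h * x) + k * (v * s) ≈⟨ distribˡ k _ _ ⟨
    k * (h * x + v * s)       ∎

  ∑-ups-bracket : ∀ {n} (a b : Subset n) → Empty (a ∩ b) → ∀ y →
    ∑ (ups y) [ a , b ] ≈ 2# * ∑∈ a (λ i → [ a - i , b ] y)
  ∑-ups-bracket []      []      _    []      = sym (zeroʳ 2#)
  ∑-ups-bracket (p ∷ a) (q ∷ b) disj (u ∷ y) = begin
    ∑ (ups (u ∷ y)) [ p ∷ a , q ∷ b ]
      ≈⟨ ∑-cong (ups (u ∷ y)) (bracket-∷ p q a b) ⟩
    ∑ (ups (u ∷ y)) (factor p q ⊗ [ a , b ])
      ≈⟨ ∑-ups-⊗ (factor p q) [ a , b ] u y ⟩
    ∂₁ (factor p q) u * [ a , b ] y + factor p q u * ∑ (ups y) [ a , b ]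
      ≈⟨ +-cong (*-congʳ (∂₁-factor p q (head-disjoint p q disj) u))
                (*-congˡ (∑-ups-bracket a b (drop-∷-Empty disj) y)) ⟩
    (2# * (if p then factor false q u else 0#)) * [ a , b ] y
      + factor p q u * (2# * ∑∈ a (λ i → [ a - i , b ] y))
      ≈⟨ pull-scalar 2# (if p then factor false q u else 0#) _ _ _ ⟩
    2# * ((if p then factor false q u else 0#) * [ a , b ] y
          + factor p q u * ∑∈ a (λ i → [ a - i , b ] y))
      ≈⟨ *-congˡ (+-cong (head p) tail) ⟩
    2# * ((if p then [ (p ∷ a) - zero , q ∷ b ] (u ∷ y) else 0#)
          + ∑∈ a (λ i → [ (p ∷ a) - suc i , q ∷ b ] (u ∷ y)))
      ≡⟨ ≡.cong (2# *_) (≡.sym (∑∈-∷ p a _)) ⟩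
    2# * ∑∈ (p ∷ a) (λ i → [ (p ∷ a) - i , q ∷ b ] (u ∷ y))
      ∎
    where
    head : ∀ p → (if p then factor false q u else 0#) * [ a , b ] y
                 ≈ (if p then [ (p ∷ a) - zero , q ∷ b ] (u ∷ y) else 0#)
    head true  = *-congˡ (reflexive (≡.cong (λ a′ → [ a′ , b ] y) (≡.sym (p─⊥≡p a))))
    head false = zeroˡ _
    tail : factor p q u * ∑∈ a (λ i → [ a - i , b ] y)
           ≈ ∑∈ a (λ i → [ (p ∷ a) - suc i , q ∷ b ] (u ∷ y))
    tail = ∑∈-distribˡ (factor p q u) a _

  ∑-downs-bracket : ∀ {n} (a b : Subset n) → Empty (a ∩ b) → ∀ y →
    ∑ (downs y) [ a , b ] ≈ ∑∈ (∁ a) (λ i → [ a ∪ ⁅ i ⁆ , b ] y)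
  ∑-downs-bracket []      []      _    []      = refl
  ∑-downs-bracket (p ∷ a) (q ∷ b) disj (u ∷ y) = begin
    ∑ (downs (u ∷ y)) [ p ∷ a , q ∷ b ]
      ≈⟨ ∑-cong (downs (u ∷ y)) (bracket-∷ p q a b) ⟩
    ∑ (downs (u ∷ y)) (factor p q ⊗ [ a , b ])
      ≈⟨ ∑-downs-⊗ (factor p q) [ a , b ] u y ⟩
    ε₁ (factor p q) u * [ a , b ] y + factor p q u * ∑ (downs y) [ a , b ]
      ≈⟨ +-cong (*-congʳ (ε₁-factor p q (head-disjoint p q disj) u))
                (*-congˡ (∑-downs-bracket a b (drop-∷-Empty disj) y)) ⟩
    (if not p then factor true q u else 0#) * [ a , b ] y
      + factor p q u * ∑∈ (∁ a) (λ i → [ a ∪ ⁅ i ⁆ , b ] y)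
      ≈⟨ +-cong (head p) tail ⟩
    (if not p then [ (p ∷ a) ∪ ⁅ zero ⁆ , q ∷ b ] (u ∷ y) else 0#)
      + ∑∈ (∁ a) (λ i → [ (p ∷ a) ∪ ⁅ suc i ⁆ , q ∷ b ] (u ∷ y))
      ≡⟨ ≡.sym (∑∈-∷ (not p) (∁ a) _) ⟩
    ∑∈ (∁ (p ∷ a)) (λ i → [ (p ∷ a) ∪ ⁅ i ⁆ , q ∷ b ] (u ∷ y))
      ∎
    where
    head : ∀ p → (if not p then factor true q u else 0#) * [ a , b ] y
                 ≈ (if not p then [ (p ∷ a) ∪ ⁅ zero ⁆ , q ∷ b ] (u ∷ y) else 0#)
    head false = *-congˡ (reflexive (≡.cong (λ a′ → [ a′ , b ] y) (≡.sym (∪-identityʳ a))))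
    head true  = zeroˡ _
    tail : factor p q u * ∑∈ (∁ a) (λ i → [ a ∪ ⁅ i ⁆ , b ] y)
           ≈ ∑∈ (∁ a) (λ i → [ (p ∷ a) ∪ ⁅ suc i ⁆ , q ∷ b ] (u ∷ y))
    tail = trans (∑∈-distribˡ (factor p q u) (∁ a) _)
                 (reflexive (≡.cong (λ p′ → ∑∈ (∁ a) (λ i → factor p′ q u * [ a ∪ ⁅ i ⁆ , b ] y))
                                    (≡.sym (∨-identityʳ p))))

lemma2p5 : ∀ {c ℓ} (F : Field c ℓ) (n : ℕ) (a b : Subset n) → Empty (a ∩ b) →
    let open Over F in
      (∂ [ a , b ] ≋ (2# · Σ∈ a (λ i → [ a - i , b ])))
      × (ε [ a , b ] ≋ Σ∉ a (λ γ → [ a ∪ ⁅ γ ⁆ , b ]))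
lemma2p5 F n a b disj = ∂-bracket , ε-bracket
  where
  open Field F hiding (zero; _-_)
  open Over F
  open Coefficients F
  open import Relation.Binary.Reasoning.Setoid setoid

  ∂-bracket : ∂ [ a , b ] ≋ (2# · Σ∈ a (λ i → [ a - i , b ]))
  ∂-bracket y = begin
    ∂ [ a , b ] y                        ≈⟨ ∂-coeff [ a , b ] y ⟩
    ∑ (ups y) [ a , b ]                  ≈⟨ ∑-ups-bracket a b disj y ⟩
    2# * ∑∈ a (λ i → [ a - i , b ] y)    ≈⟨ *-congˡ (Σ∈-apply a _ y) ⟨
    2# * Σ∈ a (λ i → [ a - i , b ]) y    ∎

  ε-bracket : ε [ a , b ] ≋ Σ∉ a (λ γ → [ a ∪ ⁅ γ ⁆ , b ])
  ε-bracket y = begin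
    ε [ a , b ] y                              ≈⟨ ε-coeff [ a , b ] y ⟩
    ∑ (downs y) [ a , b ]                      ≈⟨ ∑-downs-bracket a b disj y ⟩
    ∑∈ (∁ a) (λ γ → [ a ∪ ⁅ γ ⁆ , b ] y)       ≈⟨ Σ∉-apply a _ y ⟨
    Σ∉ a (λ γ → [ a ∪ ⁅ γ ⁆ , b ]) y           ∎
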